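{- Let $\Gamma$ be a finite digraph of valency $2$ and $G\leq\mathrm{Aut}(\Gamma)$. If $\Gamma$ is $(G,2)$-geodesic-transitive, then $\Gamma$ is $(G,2)$-arc-transitive.
   Context: A digraph $\Gamma$ consists of a finite vertex set $V(\Gamma)$ with an antisymmetric irreflexive relation $\rightarrow$; an arc is an ordered pair $(u,v)$ with $u\rightarrow v$; $\Gamma^+(v)=\{w: v\rightarrow w\}$, and valency $k$ means $|\Gamma^+(v)|=|\{w:w\rightarrow v\}|=k$ for all $v$. The distance $d_\Gamma(u,v)$ is the length of a shortest directed path from $u$ to $v$. An $s$-arc is a sequence $(v_0,\dots,v_s)$ with $v_i\rightarrow v_{i+1}$ for all $i$; it is an $s$-geodesic if $d_\Gamma(v_0,v_s)=s$. $\Gamma$ is $(G,s)$-geodesic-transitive if $G$ is transitive on the set of $i$-geodesics for each $i\leq s$, and $(G,2)$-arc-transitive if $G$ is transitive on the set of $2$-arcs. -}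

module Defs where

open import Data.Nat using (ℕ; zero; suc; _<_; _≤_)
open import Data.Bool using (Bool; true; false)
open import Data.Fin using (Fin; zero; suc; inject₁)
open import Data.Fin.Subset using (Subset; ∣_∣)
open import Data.Fin.Permutation using (Permutation′; _⟨$⟩ʳ_; _∘ₚ_; flip; id; _≈_)
open import Data.Vec using (Vec; tabulate; lookup; map; head; last)
open import Data.Product using (Σ; _×_; ∃)
open import Relation.Nullary using (¬_)
open import Relation.Binary.PropositionalEquality using (_≡_)

record Digraph (n : ℕ) : Set where
  field
    arc     : Fin n → Fin n → Bool
    irrefl  : ∀ v → arc v v ≡ false
    antisym : ∀ u v → arc u v ≡ true → arc v u ≡ false

open Digraph public

_⟶[_]_ : ∀ {n} → Fin n → Digraph n → Fin n → Set
u ⟶[ Γ ] v = arc Γ u v ≡ true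

outNbhd : ∀ {n} → Digraph n → Fin n → Subset n
outNbhd Γ v = tabulate (λ w → arc Γ v w)

inNbhd : ∀ {n} → Digraph n → Fin n → Subset n
inNbhd Γ v = tabulate (λ w → arc Γ w v)

HasValency : ∀ {n} → Digraph n → ℕ → Set
HasValency Γ k = ∀ v → (∣ outNbhd Γ v ∣ ≡ k) × (∣ inNbhd Γ v ∣ ≡ k)

IsArc : ∀ {n} (Γ : Digraph n) (s : ℕ) → Vec (Fin n) (suc s) → Set
IsArc Γ s p = ∀ (i : Fin s) → lookup p (inject₁ i) ⟶[ Γ ] lookup p (suc i)

Arc : ∀ {n} → Digraph n → ℕ → Set
Arc {n} Γ s = Σ (Vec (Fin n) (suc s)) (IsArc Γ s)

PathOfLength : ∀ {n} → Digraph n → ℕ → Fin n → Fin n → Set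
PathOfLength {n} Γ t u v =
  Σ (Vec (Fin n) (suc t)) λ p → IsArc Γ t p × (head p ≡ u) × (last p ≡ v)

Distance≡ : ∀ {n} → Digraph n → Fin n → Fin n → ℕ → Set
Distance≡ Γ u v s = PathOfLength Γ s u v × (∀ t → t < s → ¬ PathOfLength Γ t u v)

IsGeodesic : ∀ {n} (Γ : Digraph n) (s : ℕ) → Vec (Fin n) (suc s) → Set
IsGeodesic Γ s p = IsArc Γ s p × Distance≡ Γ (head p) (last p) s

IsAut : ∀ {n} → Digraph n → Permutation′ n → Set
IsAut Γ g = ∀ u v → arc Γ (g ⟨$⟩ʳ u) (g ⟨$⟩ʳ v) ≡ arc Γ u v

record IsSubgroupOfAut {n} (Γ : Digraph n) (G : Permutation′ n → Set) : Set where
  field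
    resp-≈ : ∀ {g h} → g ≈ h → G g → G h
    aut    : ∀ {g} → G g → IsAut Γ g
    has-id : G id
    closed : ∀ {g h} → G g → G h → G (g ∘ₚ h)
    inv    : ∀ {g} → G g → G (flip g)

TransitiveOn : ∀ {n m} → (Permutation′ n → Set) → (Vec (Fin n) m → Set) → Set
TransitiveOn G S = ∀ p q → S p → S q → ∃ λ g → G g × (map (g ⟨$⟩ʳ_) p ≡ q)

GeodesicTransitive : ∀ {n} → Digraph n → (Permutation′ n → Set) → ℕ → Set
GeodesicTransitive Γ G s = ∀ i → i ≤ s → TransitiveOn G (IsGeodesic Γ i)

ArcTransitive : ∀ {n} → Digraph n → (Permutation′ n → Set) → ℕ → Set
ArcTransitive Γ G s = TransitiveOn G (IsArc Γ s)

{-# OPTIONS --safe #-}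
module Submission where

-- A 1-geodesic is just an arc, so G is transitive on arcs.  If a → b → c and
-- a → c, the element g of G mapping the arc (a, b) to (a, c) gives a → g c and
-- c → g c, so b, c and g c are three distinct out-neighbours of a, which valency
-- 2 forbids.  Hence Γ has no transitive triangles, every 2-arc is a 2-geodesic,
-- and transitivity on 2-geodesics is transitivity on 2-arcs.

open import Defs
open import Data.Nat using (ℕ; zero; suc; _≤_; _<_; z≤n; s≤s)
open import Data.Nat.Properties using (≤-refl; ≤-reflexive; ≤-<-trans; <-irrefl)
open import Data.Fin using (Fin; zero; suc)
open import Data.Fin.Subset using (Subset; _∈_; _-_; ∣_∣)
open import Data.Fin.Subset.Properties using (x∈p∧x≢y⇒x∈p-y; x∈p⇒∣p-x∣<∣p∣)
open import Data.Fin.Permutation using (Permutation′; _⟨$⟩ʳ_)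
open import Data.List as List using (List; length)
open import Data.List.Relation.Unary.All as All using (All)
open import Data.List.Relation.Unary.Unique.Propositional using (Unique)
open import Data.List.Relation.Unary.AllPairs using ([]; _∷_)
open import Data.Vec using ([]; _∷_)
open import Data.Vec.Properties using (lookup⇒[]=; lookup∘tabulate; ∷-injectiveˡ; ∷-injectiveʳ)
open import Data.Product using (_,_; proj₁)
open import Relation.Nullary using (¬_)
open import Relation.Binary.PropositionalEquality

distinct-members≤∣p∣ : ∀ {n} {p : Subset n} {xs : List (Fin n)} →
  Unique xs → All (_∈ p) xs → length xs ≤ ∣ p ∣
distinct-members≤∣p∣ [] All.[] = z≤n
distinct-members≤∣p∣ {p = p} {x List.∷ xs} (x≢xs ∷ xs-unique) (x∈p All.∷ xs⊆p) =
  ≤-<-trans (distinct-members≤∣p∣ xs-unique xs⊆p-x) (x∈p⇒∣p-x∣<∣p∣ x∈p)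
  where
  xs⊆p-x : All (λ y → y ∈ p - x) xs
  xs⊆p-x = All.zipWith (λ (y∈p , x≢y) → x∈p∧x≢y⇒x∈p-y y∈p (≢-sym x≢y)) (xs⊆p , x≢xs)

module _ {n : ℕ} (Γ : Digraph n) where

  ⟶⇒∈outNbhd : ∀ {u v} → u ⟶[ Γ ] v → v ∈ outNbhd Γ u
  ⟶⇒∈outNbhd {u} {v} u⟶v = lookup⇒[]= v _ (trans (lookup∘tabulate (arc Γ u) v) u⟶v)

  ⟶-irreflexive : ∀ {u v} → u ⟶[ Γ ] v → u ≢ v
  ⟶-irreflexive {u} u⟶u refl with trans (sym u⟶u) (irrefl Γ u)
  ... | ()

  ⟶-asymmetric : ∀ {u v} → u ⟶[ Γ ] v → ¬ v ⟶[ Γ ] u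
  ⟶-asymmetric {u} {v} u⟶v v⟶u with trans (sym v⟶u) (antisym Γ u v u⟶v)
  ... | ()

  aut-preserves-⟶ : ∀ {g u v} → IsAut Γ g → u ⟶[ Γ ] v → (g ⟨$⟩ʳ u) ⟶[ Γ ] (g ⟨$⟩ʳ v)
  aut-preserves-⟶ {u = u} {v} g-aut u⟶v = trans (g-aut u v) u⟶v

  path₀⇒≡ : ∀ {u v} → PathOfLength Γ 0 u v → u ≡ v
  path₀⇒≡ (_ ∷ [] , _ , refl , refl) = refl

  path₁⇒⟶ : ∀ {u v} → PathOfLength Γ 1 u v → u ⟶[ Γ ] v
  path₁⇒⟶ (_ ∷ _ ∷ [] , arcs , refl , refl) = arcs zero

  arc⇒geodesic₁ : ∀ {u v} → u ⟶[ Γ ] v → IsGeodesic Γ 1 (u ∷ v ∷ [])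
  arc⇒geodesic₁ {u} {v} u⟶v = arcs , (u ∷ v ∷ [] , arcs , refl , refl) , shorter
    where
    arcs : IsArc Γ 1 (u ∷ v ∷ [])
    arcs zero = u⟶v
    shorter : ∀ t → t < 1 → ¬ PathOfLength Γ t u v
    shorter zero _ path = ⟶-irreflexive u⟶v (path₀⇒≡ path)
    shorter (suc _) (s≤s ())

  TransitiveTriangleFree : Set
  TransitiveTriangleFree = ∀ {a b c} → a ⟶[ Γ ] b → b ⟶[ Γ ] c → ¬ a ⟶[ Γ ] c

  triangle-free⇒arc⇒geodesic₂ : TransitiveTriangleFree →
    ∀ p → IsArc Γ 2 p → IsGeodesic Γ 2 p
  triangle-free⇒arc⇒geodesic₂ no-triangle (a ∷ b ∷ c ∷ []) arcs =
    arcs , (a ∷ b ∷ c ∷ [] , arcs , refl , refl) , shorter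
    where
    shorter : ∀ t → t < 2 → ¬ PathOfLength Γ t a c
    shorter zero _ path with path₀⇒≡ path
    ... | refl = ⟶-asymmetric (arcs zero) (arcs (suc zero))
    shorter (suc zero) _ path = no-triangle (arcs zero) (arcs (suc zero)) (path₁⇒⟶ path)
    shorter (suc (suc _)) (s≤s (s≤s ()))

  rotated-triangle⇒3≤outdegree : ∀ {g a b c} → IsAut Γ g →
    g ⟨$⟩ʳ a ≡ a → g ⟨$⟩ʳ b ≡ c →
    a ⟶[ Γ ] b → b ⟶[ Γ ] c → a ⟶[ Γ ] c → 3 ≤ ∣ outNbhd Γ a ∣
  rotated-triangle⇒3≤outdegree {g} {a} {b} {c} g-aut ga≡a gb≡c a⟶b b⟶c a⟶c =
    distinct-members≤∣p∣
      ((b≢c All.∷ b≢gc All.∷ All.[]) ∷ (c≢gc All.∷ All.[]) ∷ All.[] ∷ [])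
      (⟶⇒∈outNbhd a⟶b All.∷ ⟶⇒∈outNbhd a⟶c All.∷ ⟶⇒∈outNbhd a⟶gc All.∷ All.[])
    where
    a⟶gc : a ⟶[ Γ ] (g ⟨$⟩ʳ c)
    a⟶gc = subst (λ x → x ⟶[ Γ ] (g ⟨$⟩ʳ c)) ga≡a (aut-preserves-⟶ {g} g-aut a⟶c)
    c⟶gc : c ⟶[ Γ ] (g ⟨$⟩ʳ c)
    c⟶gc = subst (λ x → x ⟶[ Γ ] (g ⟨$⟩ʳ c)) gb≡c (aut-preserves-⟶ {g} g-aut b⟶c)
    b≢c : b ≢ c
    b≢c = ⟶-irreflexive b⟶c
    c≢gc : c ≢ g ⟨$⟩ʳ c
    c≢gc = ⟶-irreflexive c⟶gc
    b≢gc : b ≢ g ⟨$⟩ʳ c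
    b≢gc refl = ⟶-asymmetric b⟶c c⟶gc

  arc-transitive⇒triangle-free : ∀ {G : Permutation′ n → Set} →
    (∀ a → ∣ outNbhd Γ a ∣ ≤ 2) → (∀ {g} → G g → IsAut Γ g) →
    TransitiveOn G (IsGeodesic Γ 1) → TransitiveTriangleFree
  arc-transitive⇒triangle-free outdegree≤2 aut transitive {a} {b} {c} a⟶b b⟶c a⟶c
    with transitive (a ∷ b ∷ []) (a ∷ c ∷ []) (arc⇒geodesic₁ a⟶b) (arc⇒geodesic₁ a⟶c)
  ... | g , Gg , gab≡ac =
    <-irrefl refl (≤-<-trans (outdegree≤2 a) (rotated-triangle⇒3≤outdegree {g} (aut Gg)
      (∷-injectiveˡ gab≡ac) (∷-injectiveˡ (∷-injectiveʳ gab≡ac)) a⟶b b⟶c a⟶c))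

lemma4p2 : ∀ {n : ℕ} (Γ : Digraph n) (G : Permutation′ n → Set) →
    HasValency Γ 2 → IsSubgroupOfAut Γ G →
    GeodesicTransitive Γ G 2 → ArcTransitive Γ G 2
lemma4p2 Γ G valency G≤AutΓ geodesic-transitive p q p-arc q-arc =
  geodesic-transitive 2 ≤-refl p q (arc⇒geodesic₂ p p-arc) (arc⇒geodesic₂ q q-arc)
  where
  no-triangle : TransitiveTriangleFree Γ
  no-triangle = arc-transitive⇒triangle-free Γ (λ a → ≤-reflexive (proj₁ (valency a)))
    (IsSubgroupOfAut.aut G≤AutΓ) (geodesic-transitive 1 (s≤s z≤n))
  arc⇒geodesic₂ : ∀ p → IsArc Γ 2 p → IsGeodesic Γ 2 p
  arc⇒geodesic₂ = triangle-free⇒arc⇒geodesic₂ Γ no-triangle
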